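{- Let $r\ge 0$ be an integer and $G$ a $(2r+1)$-regular graph on $n$ vertices. Let $\tau$ be a threshold assignment for $G$ with average threshold $\sum_v \tau(v)/n = r+1$. Then every $\tau$-dynamic monopoly of $G$ has at least $n/(4r+2)$ vertices.
   Context: Graphs are finite, undirected, simple. A threshold assignment for $G$ is a function $\tau:V(G)\to\mathbb{N}\cup\{0\}$ with $\tau(v)\le \deg(v)$ for every $v$. For $M\subseteq V(G)$, the $\tau$-dynamic process starting from $M$ is $D_0=M$ and, for $i\ge0$, $D_{i+1}$ = set of vertices $v\notin D_0\cup\dots\cup D_i$ with at least $\tau(v)$ neighbours in $D_0\cup\dots\cup D_i$; $M$ is a $\tau$-dynamic monopoly (dynamo) if $\bigcup_i D_i=V(G)$. -}

module Defs where

open import Data.Nat using (ℕ; zero; suc; _+_; _*_; _≤_; _≤ᵇ_)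
open import Data.Bool using (Bool; true; false; _∧_; _∨_; not; if_then_else_)
open import Data.Fin using (Fin)
open import Data.Vec using (Vec; tabulate; lookup; count)
open import Data.Vec.Functional using (foldr)
open import Data.Fin.Subset using (Subset; ∣_∣; ⊤; _∈_)
open import Data.Product using (∃)
open import Relation.Binary.PropositionalEquality using (_≡_)

record Graph (n : ℕ) : Set where
  field
    adj     : Fin n → Fin n → Bool
    symm    : ∀ u v → adj u v ≡ adj v u
    irrefl  : ∀ v → adj v v ≡ false
open Graph public

countᶠ : {n : ℕ} → (Fin n → Bool) → ℕ
countᶠ {n} p = foldr (λ b k → if b then suc k else k) 0 p

deg : {n : ℕ} → Graph n → Fin n → ℕ
deg G v = countᶠ (adj G v)

Regular : {n : ℕ} → ℕ → Graph n → Set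
Regular d G = ∀ v → deg G v ≡ d

IsThreshold : {n : ℕ} → Graph n → (Fin n → ℕ) → Set
IsThreshold G τ = ∀ v → τ v ≤ deg G v

sumᶠ : {n : ℕ} → (Fin n → ℕ) → ℕ
sumᶠ f = foldr _+_ 0 f

mem : {n : ℕ} → Subset n → Fin n → Bool
mem S v = lookup S v

nbrsIn : {n : ℕ} → Graph n → Subset n → Fin n → ℕ
nbrsIn G S v = countᶠ (λ u → adj G v u ∧ mem S u)

-- One step of the τ-dynamic process, on the cumulative set
-- S = D₀ ∪ … ∪ Dᵢ : S ∪ D_{i+1}, where D_{i+1} is the set of vertices
-- not in S with at least τ(v) neighbours in S.
step : {n : ℕ} → Graph n → (Fin n → ℕ) → Subset n → Subset n
step G τ S = tabulate (λ v → mem S v ∨ (not (mem S v) ∧ (τ v ≤ᵇ nbrsIn G S v)))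

reached : {n : ℕ} → Graph n → (Fin n → ℕ) → Subset n → ℕ → Subset n
reached G τ M zero    = M
reached G τ M (suc i) = step G τ (reached G τ M i)

-- M is a τ-dynamic monopoly: ⋃ᵢ Dᵢ = V(G)
-- (the union is attained at some finite stage since the Dᵢ are increasing in a finite set)
IsDynamo : {n : ℕ} → Graph n → (Fin n → ℕ) → Subset n → Set
IsDynamo G τ M = ∀ v → ∃ λ i → v ∈ reached G τ M i

-- Let t(v) be the round in which v becomes active and orient every edge from
-- the endpoint activated earlier to the one activated later (edges inside a
-- round stay unoriented). A vertex outside M is activated by at least τ(v)
-- neighbours of strictly smaller t, so τ(v) is at most its in-degree; a
-- vertex of M only has τ(v) ≤ deg(v). Each edge is counted at most once
-- among the in-degrees, hence Σ τ ≤ Σ_{v∈M} deg(v) + |E|. For a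
-- (2r+1)-regular graph with Σ τ = (r+1)n this reads
-- (r+1)n ≤ (2r+1)|M| + (2r+1)n/2, i.e. n ≤ (4r+2)|M|.
module Submission where

open import Defs
open import Data.Nat using (ℕ; zero; suc; _+_; _*_; _≤_; _<_; _<ᵇ_; _≤ᵇ_; z≤n; s≤s)
open import Data.Nat.Properties
open import Data.Nat.Solver using (module +-*-Solver)
open import Data.Bool using (Bool; true; false; _∧_; _∨_; not; if_then_else_; T)
open import Data.Bool.Properties using (T-∧)
open import Data.Fin using (Fin; zero; suc)
open import Data.Fin.Subset using (Subset; ∣_∣)
open import Data.Vec using (_∷_; [])
open import Data.Vec.Properties using (lookup∘tabulate; []=⇒lookup)
open import Data.Product using (∃; _×_; _,_; proj₁; proj₂)
open import Data.Empty using (⊥-elim)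
open import Data.Unit using (tt)
open import Function using (_∘_; Equivalence)
open import Relation.Nullary using (¬_)
open import Relation.Binary.PropositionalEquality
  using (_≡_; refl; sym; trans; cong; cong₂; subst; module ≡-Reasoning)
open import Algebra.Properties.CommutativeMonoid.Sum +-0-commutativeMonoid
  using (∑-distrib-+; ∑-comm; sum-cong-≗)

indicator : Bool → ℕ
indicator b = if b then 1 else 0

sumᶠ-mono-≤ : ∀ {n} {f g : Fin n → ℕ} → (∀ i → f i ≤ g i) → sumᶠ f ≤ sumᶠ g
sumᶠ-mono-≤ {zero}  f≤g = z≤n
sumᶠ-mono-≤ {suc n} f≤g = +-mono-≤ (f≤g zero) (sumᶠ-mono-≤ (f≤g ∘ suc))

sumᶠ-const : ∀ {n} {f : Fin n → ℕ} k → (∀ i → f i ≡ k) → sumᶠ f ≡ n * k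
sumᶠ-const {zero}  k f≡k = refl
sumᶠ-const {suc n} k f≡k = cong₂ _+_ (f≡k zero) (sumᶠ-const k (f≡k ∘ suc))

countᶠ≡sumᶠ : ∀ {n} (p : Fin n → Bool) → countᶠ p ≡ sumᶠ (indicator ∘ p)
countᶠ≡sumᶠ {zero}  p = refl
countᶠ≡sumᶠ {suc n} p with p zero
... | true  = cong suc (countᶠ≡sumᶠ (p ∘ suc))
... | false = countᶠ≡sumᶠ (p ∘ suc)

countᶠ-mono : ∀ {n} {p q : Fin n → Bool} → (∀ i → T (p i) → T (q i)) → countᶠ p ≤ countᶠ q
countᶠ-mono {p = p} {q} p⇒q = begin
  countᶠ p              ≡⟨ countᶠ≡sumᶠ p ⟩
  sumᶠ (indicator ∘ p)  ≤⟨ sumᶠ-mono-≤ (λ i → indicator-mono (p⇒q i)) ⟩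
  sumᶠ (indicator ∘ q)  ≡⟨ countᶠ≡sumᶠ q ⟨
  countᶠ q              ∎
  where
  open ≤-Reasoning
  indicator-mono : ∀ {a b} → (T a → T b) → indicator a ≤ indicator b
  indicator-mono {false}         _   = z≤n
  indicator-mono {true}  {true}  _   = ≤-refl
  indicator-mono {true}  {false} a⇒b = ⊥-elim (a⇒b tt)

sumᶠ-over-subset : ∀ {n} (S : Subset n) k → sumᶠ (λ v → if mem S v then k else 0) ≡ k * ∣ S ∣
sumᶠ-over-subset []          k = sym (*-zeroʳ k)
sumᶠ-over-subset (true ∷ S)  k = trans (cong (k +_) (sumᶠ-over-subset S k)) (sym (*-suc k ∣ S ∣))
sumᶠ-over-subset (false ∷ S) k = sumᶠ-over-subset S k

least-index : (f : ℕ → Bool) → ∀ k → T (f k) → ∃ λ m → T (f m) × (∀ j → j < m → ¬ T (f j))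
least-index f zero    fk = zero , fk , λ _ ()
least-index f (suc k) fk with f zero in f0
... | true  = zero , subst T (sym f0) tt , λ _ ()
... | false with least-index (f ∘ suc) k fk
...   | m , fm , below = suc m , fm , earlier
  where
  earlier : ∀ j → j < suc m → ¬ T (f j)
  earlier zero    _         = subst (¬_ ∘ T) (sym f0) (λ ())
  earlier (suc j) (s≤s j<m) = below j j<m

indicator-∧-disjoint : ∀ a x y → ¬ (T x × T y) → indicator (a ∧ x) + indicator (a ∧ y) ≤ indicator a
indicator-∧-disjoint false _     _     _     = z≤n
indicator-∧-disjoint true  false false _     = z≤n
indicator-∧-disjoint true  false true  _     = ≤-refl
indicator-∧-disjoint true  true  false _     = ≤-refl
indicator-∧-disjoint true  true  true  ¬both = ⊥-elim (¬both (tt , tt))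

backDeg : ∀ {n} → Graph n → (Fin n → ℕ) → Fin n → ℕ
backDeg G t v = countᶠ (λ u → adj G v u ∧ (t u <ᵇ t v))

twice-sum-backDeg≤sum-deg : ∀ {n} (G : Graph n) (t : Fin n → ℕ) →
                            2 * sumᶠ (backDeg G t) ≤ sumᶠ (deg G)
twice-sum-backDeg≤sum-deg {n} G t = begin
  2 * sumᶠ (backDeg G t)              ≡⟨ cong (sumᶠ (backDeg G t) +_) (+-identityʳ (sumᶠ (backDeg G t))) ⟩
  sumᶠ (backDeg G t) + sumᶠ (backDeg G t) ≡⟨ cong₂ _+_ backDeg-as-ΣΣ (trans backDeg-as-ΣΣ (∑-comm before)) ⟩
  ΣΣ before + ΣΣ after                ≡⟨ ∑-distrib-+ (λ v → sumᶠ (before v)) (λ v → sumᶠ (after v)) ⟨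
  sumᶠ (λ v → sumᶠ (before v) + sumᶠ (after v))
    ≤⟨ sumᶠ-mono-≤ split≤deg ⟩
  sumᶠ (deg G)                        ∎
  where
  open ≤-Reasoning
  back : Fin n → Fin n → Bool
  back v u = adj G v u ∧ (t u <ᵇ t v)
  before after : Fin n → Fin n → ℕ
  before v u = indicator (back v u)
  after  v u = indicator (back u v)
  ΣΣ : (Fin n → Fin n → ℕ) → ℕ
  ΣΣ f = sumᶠ (λ v → sumᶠ (f v))

  backDeg-as-ΣΣ : sumᶠ (backDeg G t) ≡ ΣΣ before
  backDeg-as-ΣΣ = sum-cong-≗ (countᶠ≡sumᶠ ∘ back)

  edge-counted-once : ∀ v u → before v u + after v u ≤ indicator (adj G v u)
  edge-counted-once v u rewrite symm G u v =
    indicator-∧-disjoint (adj G v u) (t u <ᵇ t v) (t v <ᵇ t u)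
      (λ (u<v , v<u) → <-asym (<ᵇ⇒< (t u) (t v) u<v) (<ᵇ⇒< (t v) (t u) v<u))

  split≤deg : ∀ v → sumᶠ (before v) + sumᶠ (after v) ≤ deg G v
  split≤deg v = begin
    sumᶠ (before v) + sumᶠ (after v)        ≡⟨ ∑-distrib-+ (before v) (after v) ⟨
    sumᶠ (λ u → before v u + after v u)      ≤⟨ sumᶠ-mono-≤ (edge-counted-once v) ⟩
    sumᶠ (indicator ∘ adj G v)              ≡⟨ countᶠ≡sumᶠ (adj G v) ⟨
    deg G v                                 ∎

newly-reached⇒τ≤nbrsIn : ∀ {n} (G : Graph n) τ (S : Subset n) v →
                         ¬ T (mem S v) → T (mem (step G τ S) v) → τ v ≤ nbrsIn G S v
newly-reached⇒τ≤nbrsIn G τ S v v∉S v∈step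
  rewrite lookup∘tabulate (λ u → mem S u ∨ (not (mem S u) ∧ (τ u ≤ᵇ nbrsIn G S u))) v
  with mem S v
... | true  = ⊥-elim (v∉S tt)
... | false = ≤ᵇ⇒≤ (τ v) (nbrsIn G S v) v∈step

module Activation {n} (G : Graph n) (τ : Fin n → ℕ) (M : Subset n) (dyn : IsDynamo G τ M) where

  reachedᵇ : Fin n → ℕ → Bool
  reachedᵇ v i = mem (reached G τ M i) v

  first-reach : ∀ v → ∃ λ m → T (reachedᵇ v m) × (∀ j → j < m → ¬ T (reachedᵇ v j))
  first-reach v = least-index (reachedᵇ v) (proj₁ (dyn v))
                    (subst T (sym ([]=⇒lookup (proj₂ (dyn v)))) tt)

  time : Fin n → ℕ
  time v = proj₁ (first-reach v)

  reached-at-time : ∀ v → T (reachedᵇ v (time v))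
  reached-at-time v = proj₁ (proj₂ (first-reach v))

  unreached-before-time : ∀ v j → j < time v → ¬ T (reachedᵇ v j)
  unreached-before-time v = proj₂ (proj₂ (first-reach v))

  time-≤ : ∀ u k → T (reachedᵇ u k) → time u ≤ k
  time-≤ u k reached = ≮⇒≥ (λ k<time → unreached-before-time u k k<time reached)

  τ≤backDeg-reached-at : ∀ v k → time v ≡ suc k → τ v ≤ backDeg G time v
  τ≤backDeg-reached-at v k time≡ = begin
    τ v                          ≤⟨ newly-reached⇒τ≤nbrsIn G τ (reached G τ M k) v v∉Rₖ v∈step ⟩
    nbrsIn G (reached G τ M k) v ≤⟨ countᶠ-mono reached-nbr-is-earlier ⟩
    backDeg G time v             ∎
    where
    open ≤-Reasoning
    k<time : k < time v
    k<time = subst (k <_) (sym time≡) ≤-refl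
    v∉Rₖ : ¬ T (reachedᵇ v k)
    v∉Rₖ = unreached-before-time v k k<time
    v∈step : T (reachedᵇ v (suc k))
    v∈step = subst (T ∘ reachedᵇ v) time≡ (reached-at-time v)
    reached-nbr-is-earlier : ∀ u → T (adj G v u ∧ reachedᵇ u k) → T (adj G v u ∧ (time u <ᵇ time v))
    reached-nbr-is-earlier u vu∧u∈Rₖ =
      let vu , u∈Rₖ = Equivalence.to T-∧ vu∧u∈Rₖ
      in  Equivalence.from T-∧ (vu , <⇒<ᵇ (≤-<-trans (time-≤ u k u∈Rₖ) k<time))

  τ≤backDeg-outside : ∀ v → ¬ T (mem M v) → τ v ≤ backDeg G time v
  τ≤backDeg-outside v v∉M = by-time (time v) refl
    where
    by-time : ∀ j → time v ≡ j → τ v ≤ backDeg G time v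
    by-time zero    time≡ = ⊥-elim (v∉M (subst (T ∘ reachedᵇ v) time≡ (reached-at-time v)))
    by-time (suc k) time≡ = τ≤backDeg-reached-at v k time≡

  τ≤seed-degree+backDeg : IsThreshold G τ → ∀ v → τ v ≤ (if mem M v then deg G v else 0) + backDeg G time v
  τ≤seed-degree+backDeg τ≤deg v with mem M v in v∈?M
  ... | true  = ≤-trans (τ≤deg v) (m≤m+n (deg G v) (backDeg G time v))
  ... | false = τ≤backDeg-outside v (subst T v∈?M)

dynamo-threshold-bound : ∀ {n} (G : Graph n) τ (M : Subset n) → IsThreshold G τ → IsDynamo G τ M →
                         2 * sumᶠ τ ≤ 2 * sumᶠ (λ v → if mem M v then deg G v else 0) + sumᶠ (deg G)
dynamo-threshold-bound G τ M τ≤deg dyn = begin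
  2 * sumᶠ τ                  ≤⟨ *-monoʳ-≤ 2 (sumᶠ-mono-≤ (τ≤seed-degree+backDeg τ≤deg)) ⟩
  2 * sumᶠ (λ v → seedDeg v + backDeg G time v)
    ≡⟨ cong (2 *_) (∑-distrib-+ seedDeg (backDeg G time)) ⟩
  2 * (sumᶠ seedDeg + sumᶠ (backDeg G time))
    ≡⟨ *-distribˡ-+ 2 (sumᶠ seedDeg) (sumᶠ (backDeg G time)) ⟩
  2 * sumᶠ seedDeg + 2 * sumᶠ (backDeg G time)
    ≤⟨ +-monoʳ-≤ (2 * sumᶠ seedDeg) (twice-sum-backDeg≤sum-deg G time) ⟩
  2 * sumᶠ seedDeg + sumᶠ (deg G) ∎
  where
  open ≤-Reasoning
  open Activation G τ M dyn
  seedDeg : Fin _ → ℕ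
  seedDeg v = if mem M v then deg G v else 0

n≤[4r+2]m : ∀ r n m → 2 * ((r + 1) * n) ≤ 2 * ((2 * r + 1) * m) + n * (2 * r + 1) →
            n ≤ (4 * r + 2) * m
n≤[4r+2]m r n m hyp = +-cancelʳ-≤ (n * (2 * r + 1)) n ((4 * r + 2) * m) (begin
  n + n * (2 * r + 1)                          ≡⟨ lhs≡ ⟩
  2 * ((r + 1) * n)                            ≤⟨ hyp ⟩
  2 * ((2 * r + 1) * m) + n * (2 * r + 1)      ≡⟨ cong (_+ n * (2 * r + 1)) rhs≡ ⟩
  (4 * r + 2) * m + n * (2 * r + 1)            ∎)
  where
  open ≤-Reasoning
  open +-*-Solver
  lhs≡ : n + n * (2 * r + 1) ≡ 2 * ((r + 1) * n)
  lhs≡ = solve 2 (λ n r → n :+ n :* (con 2 :* r :+ con 1) := con 2 :* ((r :+ con 1) :* n)) refl n r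
  rhs≡ : 2 * ((2 * r + 1) * m) ≡ (4 * r + 2) * m
  rhs≡ = solve 2 (λ r m → con 2 :* ((con 2 :* r :+ con 1) :* m) := (con 4 :* r :+ con 2) :* m) refl r m

corollary2 : (r n : ℕ) (G : Graph n) → Regular (2 * r + 1) G
           → (τ : Fin n → ℕ) → IsThreshold G τ → sumᶠ τ ≡ (r + 1) * n
           → (M : Subset n) → IsDynamo G τ M
           → n ≤ (4 * r + 2) * ∣ M ∣
corollary2 r n G regular τ τ≤deg Στ≡ M dyn = n≤[4r+2]m r n ∣ M ∣ (begin
  2 * ((r + 1) * n)                                            ≡⟨ cong (2 *_) Στ≡ ⟨
  2 * sumᶠ τ                                                   ≤⟨ dynamo-threshold-bound G τ M τ≤deg dyn ⟩
  2 * sumᶠ (λ v → if mem M v then deg G v else 0) + sumᶠ (deg G)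
    ≡⟨ cong₂ (λ a b → 2 * a + b) seed-degrees total-degree ⟩
  2 * ((2 * r + 1) * ∣ M ∣) + n * (2 * r + 1)                  ∎)
  where
  open ≤-Reasoning
  seed-degrees : sumᶠ (λ v → if mem M v then deg G v else 0) ≡ (2 * r + 1) * ∣ M ∣
  seed-degrees = trans (sum-cong-≗ (λ v → cong (if mem M v then_else 0) (regular v)))
                       (sumᶠ-over-subset M (2 * r + 1))
  total-degree : sumᶠ (deg G) ≡ n * (2 * r + 1)
  total-degree = sumᶠ-const (2 * r + 1) regular
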